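{- Let $T$ be a text of length $n$ and let $\mathcal{C}=\{(i_1,j_1),\ldots,(i_c,j_c)\}$ be an overlapping net occurrence cover of $T$. Then every net occurrence of $T$ that is not in $\mathcal{C}$ is a super-occurrence of $(i-1,j+1)$ for some bridging net sub-occurrence $(i,j)$ of $\mathcal{C}$.
   Context: Positions in a string are 1-indexed; $T[i\ldots j]$ is a substring. An occurrence in $T$ is a pair $(i,j)$ of positions; $(i,j)$ is a super-occurrence of $(i',j')$ (and $(i',j')$ a sub-occurrence of $(i,j)$) if $i\le i'\le j'\le j$. A string is unique in $T$ if it occurs exactly once and repeated if it occurs at least twice. An occurrence $(i,j)$ is a net occurrence if $T[i\ldots j]$ is repeated while $T[i-1\ldots j]$ and $T[i\ldots j+1]$ are unique (with $T[i-1\ldots j]$ regarded unique when $i=1$ and $T[i\ldots j+1]$ regarded unique when $j=n$). A set $\mathcal{C}=\{(i_1,j_1),\ldots,(i_c,j_c)\}$ of net occurrences of $T$ is an overlapping net occurrence cover (ONOC) if $i_1=1$, $i_{k+1}\le j_k$ for $1\le k\le c-1$, and $j_c=n$. Its bridging net sub-occurrences (BNSOs) are the occurrences $(i_2,j_1),(i_3,j_2),\ldots,(i_c,j_{c-1})$. -}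

module Defs where

open import Data.Nat using (ℕ; zero; suc; _+_; _∸_; _≤_)
open import Data.List using (List; []; _∷_; length)
open import Data.Maybe using (Maybe; just; nothing)
open import Data.Product using (_×_; _,_; ∃-syntax)
open import Data.Sum using (_⊎_)
open import Data.List.Relation.Unary.All using (All)
open import Relation.Binary.PropositionalEquality using (_≡_; _≢_)

-- Character of T at 1-indexed position p (nothing if out of range).
charAt : ∀ {A : Set} → List A → ℕ → Maybe A
charAt []       _             = nothing
charAt (x ∷ xs) zero          = nothing
charAt (x ∷ xs) (suc zero)    = just x
charAt (x ∷ xs) (suc (suc p)) = charAt xs (suc p)

IsOcc : ∀ {A : Set} → List A → ℕ → ℕ → Set
IsOcc T i j = (1 ≤ i) × (i ≤ j) × (j ≤ length T)

SameStr : ∀ {A : Set} → List A → ℕ → ℕ → ℕ → ℕ → Set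
SameStr T i j i' j' =
  (j ∸ i ≡ j' ∸ i') × (∀ k → k ≤ j ∸ i → charAt T (i + k) ≡ charAt T (i' + k))

Repeated : ∀ {A : Set} → List A → ℕ → ℕ → Set
Repeated T i j = IsOcc T i j ×
  (∃[ i' ] ∃[ j' ] (IsOcc T i' j' × (i' ≢ i) × SameStr T i j i' j'))

Unique : ∀ {A : Set} → List A → ℕ → ℕ → Set
Unique T i j = IsOcc T i j ×
  (∀ i' j' → IsOcc T i' j' → SameStr T i j i' j' → i' ≡ i)

-- Net occurrence (boundary conventions: i = 1 / j = n count as unique extension).
IsNet : ∀ {A : Set} → List A → ℕ → ℕ → Set
IsNet T i j = Repeated T i j
  × (i ≡ 1 ⊎ Unique T (i ∸ 1) j)
  × (j ≡ length T ⊎ Unique T i (suc j))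

data Chain (n : ℕ) : List (ℕ × ℕ) → Set where
  last : ∀ {i j} → j ≡ n → Chain n ((i , j) ∷ [])
  step : ∀ {i j i' j' rest} → i' ≤ j →
         Chain n ((i' , j') ∷ rest) → Chain n ((i , j) ∷ (i' , j') ∷ rest)

data StartsAt1 : List (ℕ × ℕ) → Set where
  start : ∀ {j rest} → StartsAt1 ((1 , j) ∷ rest)

IsONOC : ∀ {A : Set} → List A → List (ℕ × ℕ) → Set
IsONOC T C = All (λ p → IsNet T (Data.Product.proj₁ p) (Data.Product.proj₂ p)) C
  × StartsAt1 C × Chain (length T) C

data BNSO : List (ℕ × ℕ) → ℕ → ℕ → Set where
  here  : ∀ {i j i' j' rest} → BNSO ((i , j) ∷ (i' , j') ∷ rest) i' j
  there : ∀ {p rest a b} → BNSO rest a b → BNSO (p ∷ rest) a b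

{-# OPTIONS --safe #-}
-- A sub-occurrence of a repeated occurrence is repeated. Hence, for a net occurrence (i , j)
-- and a repeated occurrence (i′ , j′) with i′ < i ≤ j ≤ j′, the unique T[i-1..j] would sit
-- inside the repeated T[i′..j′], which is impossible. So i′ < i forces j′ < j, and
-- symmetrically; in particular net occurrences are strictly ordered by both endpoints.
-- A net occurrence outside the cover therefore starts strictly between consecutive
-- starts i_k < i < i_{k+1}, hence j_k < j, so it contains (i_{k+1} - 1 , j_k + 1).
module Submission where

open import Defs
open import Data.Nat using (ℕ; _+_; _∸_; _≤_; _<_; s≤s; _<?_)
open import Data.Nat.Properties
open import Data.List using (List; _∷_; length)
open import Data.Product using (_×_; _,_; ∃-syntax; uncurry)
open import Data.Sum using (inj₁; inj₂)
open import Data.Empty using (⊥; ⊥-elim)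
open import Data.List.Membership.Propositional using (_∉_)
open import Data.List.Relation.Unary.Any using (here; there)
open import Data.List.Relation.Unary.All using (All; _∷_)
open import Relation.Nullary using (¬_; yes; no)
open import Relation.Binary using (tri<; tri≈; tri>)
open import Relation.Binary.PropositionalEquality using (_≡_; refl; sym; trans; cong; subst; module ≡-Reasoning)
open import Function using (_∘_)

private
  variable
    a b i j i′ j′ p q : ℕ
    C : List (ℕ × ℕ)

module _ {A : Set} {T : List A} where

  repeated-sub : Repeated T i j → i ≤ p → p ≤ q → q ≤ j → Repeated T p q
  repeated-sub {i} {j} ((1≤i , _ , j≤n) , i′ , j′ , (1≤i′ , i′≤j′ , j′≤n) , i′≢i , len , chars)
                 i≤p p≤q q≤j
    with m≤n⇒∃[o]m+o≡n i≤p | m≤n⇒∃[o]m+o≡n p≤q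
  ... | d , refl | e , refl =
    (≤-trans 1≤i (m≤m+n i d) , m≤m+n (i + d) e , ≤-trans q≤j j≤n) ,
    i′ + d , i′ + d + e , occ′ , i′≢i ∘ +-cancelʳ-≡ d i′ i ,
    trans (m+n∸m≡n (i + d) e) (sym (m+n∸m≡n (i′ + d) e)) , sameChars
    where
    d+e≤j∸i : d + e ≤ j ∸ i
    d+e≤j∸i = ≤-trans (≤-reflexive (sym (m+n∸m≡n i (d + e))))
                      (∸-monoˡ-≤ i (≤-trans (≤-reflexive (sym (+-assoc i d e))) q≤j))

    occ′ : IsOcc T (i′ + d) (i′ + d + e)
    occ′ = ≤-trans 1≤i′ (m≤m+n i′ d) , m≤m+n (i′ + d) e , (begin
      i′ + d + e    ≡⟨ +-assoc i′ d e ⟩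
      i′ + (d + e)  ≤⟨ +-monoʳ-≤ i′ d+e≤j∸i ⟩
      i′ + (j ∸ i)  ≡⟨ cong (i′ +_) len ⟩
      i′ + (j′ ∸ i′) ≡⟨ m+[n∸m]≡n i′≤j′ ⟩
      j′            ≤⟨ j′≤n ⟩
      length T      ∎)
      where open ≤-Reasoning

    sameChars : ∀ k → k ≤ i + d + e ∸ (i + d) → charAt T (i + d + k) ≡ charAt T (i′ + d + k)
    sameChars k k≤ = begin
      charAt T (i + d + k)    ≡⟨ cong (charAt T) (+-assoc i d k) ⟩
      charAt T (i + (d + k))  ≡⟨ chars (d + k) d+k≤j∸i ⟩
      charAt T (i′ + (d + k)) ≡⟨ cong (charAt T) (sym (+-assoc i′ d k)) ⟩
      charAt T (i′ + d + k)   ∎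
      where
      open ≡-Reasoning
      d+k≤j∸i : d + k ≤ j ∸ i
      d+k≤j∸i = ≤-trans (+-monoʳ-≤ d (≤-trans k≤ (≤-reflexive (m+n∸m≡n (i + d) e)))) d+e≤j∸i

  repeated⇒¬unique : Repeated T i j → ¬ Unique T i j
  repeated⇒¬unique (_ , i′ , j′ , occ′ , i′≢i , same) (_ , unique) = i′≢i (unique i′ j′ occ′ same)

  unique⇒¬inside-repeated : Unique T p q → Repeated T i j → i ≤ p → q ≤ j → ⊥
  unique⇒¬inside-repeated u@((_ , p≤q , _) , _) r i≤p q≤j =
    repeated⇒¬unique (repeated-sub r i≤p p≤q q≤j) u

  net-start-after⇒end-after : IsNet T i j → Repeated T i′ j′ → i′ < i → j′ < j
  net-start-after⇒end-after (_ , inj₁ refl , _) ((1≤i′ , _) , _) i′<1 = ⊥-elim (<⇒≱ i′<1 1≤i′)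
  net-start-after⇒end-after {j = j} {j′ = j′} (_ , inj₂ u , _) r (s≤s i′≤i-1) with j′ <? j
  ... | yes j′<j = j′<j
  ... | no j′≮j = ⊥-elim (unique⇒¬inside-repeated u r i′≤i-1 (≮⇒≥ j′≮j))

  net-end-before⇒start-before : IsNet T i j → Repeated T i′ j′ → j < j′ → i < i′
  net-end-before⇒start-before (_ , _ , inj₁ refl) ((_ , _ , j′≤n) , _) j<j′ = ⊥-elim (<⇒≱ j<j′ j′≤n)
  net-end-before⇒start-before {i = i} {i′ = i′} (_ , _ , inj₂ u) r j<j′ with i <? i′
  ... | yes i<i′ = i<i′
  ... | no i≮i′ = ⊥-elim (unique⇒¬inside-repeated u r (≮⇒≥ i≮i′) j<j′)

  net-end-determined : IsNet T i j → IsNet T i j′ → j ≡ j′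
  net-end-determined n n′ = ≤-antisym (≮⇒≥ (longer n′ n)) (≮⇒≥ (longer n n′))
    where
    longer : IsNet T i j → IsNet T i j′ → ¬ j < j′
    longer n (r′ , _) j<j′ = <-irrefl refl (net-end-before⇒start-before n r′ j<j′)

  bnso-strictly-inside : All (uncurry (IsNet T)) ((a , b) ∷ C) → Chain (length T) ((a , b) ∷ C) →
                         IsNet T i j → (i , j) ∉ (a , b) ∷ C → a < i →
                         ∃[ x ] ∃[ y ] (BNSO ((a , b) ∷ C) x y × i < x × y < j)
  bnso-strictly-inside ((r , _) ∷ _) (last refl) nij@(((_ , _ , j≤n) , _) , _) _ a<i =
    ⊥-elim (<⇒≱ (net-start-after⇒end-after nij r a<i) j≤n)
  bnso-strictly-inside {C = (a′ , _) ∷ _} {i = i} (_ ∷ net′ ∷ nets) (step _ chain) nij ∉C a<i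
    with <-cmp a′ i
  ... | tri< a′<i _ _ with bnso-strictly-inside (net′ ∷ nets) chain nij (∉C ∘ there) a′<i
  ...   | x , y , bnso , i<x , y<j = x , y , there bnso , i<x , y<j
  bnso-strictly-inside (_ ∷ net′ ∷ _) (step _ _) nij ∉C _ | tri≈ _ refl _ =
    ⊥-elim (∉C (there (here (cong (_ ,_) (net-end-determined nij net′)))))
  bnso-strictly-inside ((r , _) ∷ _) (step _ _) nij _ a<i | tri> _ _ i<a′ =
    _ , _ , here , i<a′ , net-start-after⇒end-after nij r a<i

lemma11 : {A : Set} (T : List A) (C : List (ℕ × ℕ)) → IsONOC T C →
          ∀ i j → IsNet T i j → (i , j) ∉ C →
          ∃[ a ] ∃[ b ] (BNSO C a b × (i + 1 ≤ a) × (b + 1 ≤ j))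
lemma11 T (_ ∷ _) (nets@(net₁ ∷ _) , start , chain) i j nij@(((1≤i , _) , _) , _) ∉C
  with m≤n⇒m<n∨m≡n 1≤i
... | inj₂ refl = ⊥-elim (∉C (here (cong (1 ,_) (net-end-determined {T = T} nij net₁))))
... | inj₁ 1<i with bnso-strictly-inside {T = T} nets chain nij ∉C 1<i
...   | a , b , bnso , i<a , b<j = a , b , bnso , <⇒+1≤ i<a , <⇒+1≤ b<j
  where
  <⇒+1≤ : ∀ {m n} → m < n → m + 1 ≤ n
  <⇒+1≤ {m} {n} = subst (_≤ n) (+-comm 1 m)
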